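{- Let $X$ be a topological space and $\mathcal{O}(X)$ its locale of open sets. If $M \subseteq X$ is an open subset such that the subspace $X - M$ is locally indiscrete, then the operation $U \to V = U^c \cup V \cup M$ (for $U, V \in \mathcal{O}(X)$, where $U^c = X - U$) is a weakly Boolean implication over $\mathcal{O}(X)$. Conversely, every weakly Boolean implication $\to$ over $\mathcal{O}(X)$ has the form $U \to V = U^c \cup V \cup M$ where $M = \neg X = X \to \varnothing$ is an open subset such that $X - M$ is locally indiscrete.
   Context: For a bounded distributive lattice $\mathcal{A}$ (here $\mathcal{O}(X)$, ordered by inclusion), an implication over $\mathcal{A}$ is a binary operation $\to$ on $\mathcal{A}$ which is order-reversing in its first argument and order-preserving in its second argument and satisfies $a \to a = 1$ and $(a \to b) \wedge (b \to c) \leq a \to c$ for all $a,b,c$. $\neg a$ abbreviates $a \to 0$. An implication is open if $a \wedge b \leq c$ implies $a \leq b \to c$; closed if $a \leq b \vee c$ implies $(a \to b) \vee c = 1$; weakly Boolean if both open and closed. A space is locally indiscrete if every point has an open neighbourhood whose subspace topology is indiscrete. -}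

module Defs where

open import Data.Product using (Σ; _×_; _,_)
open import Data.Sum using (_⊎_)
open import Data.Empty using (⊥)
open import Data.Unit using (⊤)
open import Relation.Nullary using (¬_)

Subset : Set → Set₁
Subset X = X → Set

_⊆_ : {X : Set} → Subset X → Subset X → Set
A ⊆ B = ∀ {x} → A x → B x

_≐_ : {X : Set} → Subset X → Subset X → Set
A ≐ B = (A ⊆ B) × (B ⊆ A)

record Space : Set₂ where
  field
    Carrier   : Set
    IsOpen    : Subset Carrier → Set₁
    open-resp : ∀ {A B} → A ≐ B → IsOpen A → IsOpen B
    open-∅    : IsOpen (λ _ → ⊥)
    open-X    : IsOpen (λ _ → ⊤)
    open-∩    : ∀ {A B} → IsOpen A → IsOpen B → IsOpen (λ x → A x × B x)
    open-⋃    : (I : Set) (F : I → Subset Carrier) →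
                (∀ i → IsOpen (F i)) → IsOpen (λ x → Σ I (λ i → F i x))

module _ (S : Space) where
  open Space S

  record Open : Set₁ where
    constructor mkOpen
    field
      set    : Subset Carrier
      isOpen : IsOpen set
  open Open public

  _≤_ : Open → Open → Set
  U ≤ V = set U ⊆ set V

  _≈_ : Open → Open → Set
  U ≈ V = set U ≐ set V

  ⊤O : Open
  ⊤O = mkOpen (λ _ → ⊤) open-X

  ⊥O : Open
  ⊥O = mkOpen (λ _ → ⊥) open-∅

  _∧O_ : Open → Open → Open
  U ∧O V = mkOpen (λ x → set U x × set V x) (open-∩ (isOpen U) (isOpen V))

  _∨O_ : Open → Open → Open
  U ∨O V = mkOpen (λ x → set U x ⊎ set V x) (open-resp eq (open-⋃ Two F Fo))
    where
      data Two : Set where l r : Two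
      F : Two → Subset Carrier
      F l = set U
      F r = set V
      Fo : ∀ i → IsOpen (F i)
      Fo l = isOpen U
      Fo r = isOpen V
      eq : (λ x → Σ Two (λ i → F i x)) ≐ (λ x → set U x ⊎ set V x)
      eq = (λ { (l , p) → Data.Sum.inj₁ p ; (r , p) → Data.Sum.inj₂ p })
         , (λ { (Data.Sum.inj₁ p) → l , p ; (Data.Sum.inj₂ p) → r , p })

  record IsImplication (_⇒_ : Open → Open → Open) : Set₁ where
    field
      antitone₁ : ∀ {a a′ b} → a ≤ a′ → (a′ ⇒ b) ≤ (a ⇒ b)
      monotone₂ : ∀ {a b b′} → b ≤ b′ → (a ⇒ b) ≤ (a ⇒ b′)
      refl⇒     : ∀ a → (a ⇒ a) ≈ ⊤O
      trans⇒    : ∀ a b c → ((a ⇒ b) ∧O (b ⇒ c)) ≤ (a ⇒ c)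

  IsOpenImp : (Open → Open → Open) → Set₁
  IsOpenImp _⇒_ = ∀ a b c → (a ∧O b) ≤ c → a ≤ (b ⇒ c)

  IsClosedImp : (Open → Open → Open) → Set₁
  IsClosedImp _⇒_ = ∀ a b c → a ≤ (b ∨O c) → ((a ⇒ b) ∨O c) ≈ ⊤O

  IsWeaklyBoolean : (Open → Open → Open) → Set₁
  IsWeaklyBoolean _⇒_ = IsImplication _⇒_ × IsOpenImp _⇒_ × IsClosedImp _⇒_

  -- The subspace X − M (M ⊆ X) is locally indiscrete: every point y of X − M
  -- has an open neighbourhood N in X − M (N = W ∩ (X − M), W open in X) whose
  -- subspace topology is indiscrete, i.e. every open subset of N (of the form
  -- V ∩ N with V open in X) is either empty or all of N.
  ComplLocallyIndiscrete : Subset Carrier → Set₁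
  ComplLocallyIndiscrete M =
    ∀ y → ¬ M y →
      Σ Open λ W → set W y ×
        (∀ (V : Open) →
           (∀ z → ¬ M z → set W z → ¬ set V z)
           ⊎ (∀ z → ¬ M z → set W z → set V z))

{-# OPTIONS --safe #-}
-- For an open set M, X − M is locally indiscrete iff ¬U ∪ M is open for every
-- open U: the indiscrete neighbourhoods of the points outside U ∪ M cover
-- ¬U − M, and conversely, if O is the largest open set avoiding a point y ∉ M,
-- then ¬O ∪ M is an indiscrete neighbourhood of y in X − M. Given this,
-- U ⇒ V = ¬U ∪ V ∪ M is open and weak Booleanness is classical pointwise logic.
-- Conversely, for a weakly Boolean ⇒ closedness gives (U ⇒ ∅) ∪ U = X and
-- openness gives V ⊆ U ⇒ V, so transitivity through X ⇒ U and V ⇒ ∅ forces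
-- U ⇒ V = ¬U ∪ V ∪ (X ⇒ ∅); in particular ¬U ∪ (X ⇒ ∅) = U ⇒ ∅ is open.
module Submission where

open import Defs
open import Level using (0ℓ; Lift; lift) renaming (suc to lsuc)
open import Axiom.ExcludedMiddle using (ExcludedMiddle)
open import Data.Product using (Σ; _×_; _,_; proj₁; proj₂)
open import Data.Sum using (_⊎_; inj₁; inj₂; [_,_]; map₁; map₂)
open import Data.Empty using (⊥-elim)
open import Data.Unit using (tt)
open import Function using (_∘_; id)
open import Relation.Nullary using (¬_; yes; no)

⊎-exchange : ∀ {A B C : Set} → A ⊎ B ⊎ C → B ⊎ A ⊎ C
⊎-exchange = [ inj₂ ∘ inj₁ , [ inj₁ , inj₂ ∘ inj₂ ] ]

module _ (em : ExcludedMiddle (lsuc 0ℓ)) (S : Space) where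
  open Space S

  lem : (P : Set) → P ⊎ ¬ P
  lem P with em {Lift (lsuc 0ℓ) P}
  ... | yes (lift p) = inj₁ p
  ... | no ¬p = inj₂ (λ p → ¬p (lift p))

  ⋃O : (I : Set) → (I → Open S) → Open S
  ⋃O I F = mkOpen (λ x → Σ I λ i → set (F i) x)
                  (open-⋃ I (λ i → set (F i)) (λ i → isOpen (F i)))

  largestOpenAvoiding : (y : Carrier) →
    Σ (Open S) λ O → ¬ set O y × (∀ (V : Open S) → ¬ set V y → set V ⊆ set O)
  largestOpenAvoiding y = ⋃O Carrier witness , avoids , contains
    where
    Witness : Carrier → Set₁
    Witness z = Σ (Open S) λ V → set V z × ¬ set V y

    witness : Carrier → Open S
    witness z with em {Witness z}
    ... | yes (V , _) = V
    ... | no _ = ⊥O S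

    avoids : ¬ Σ Carrier (λ z → set (witness z) y)
    avoids (z , wy) with em {Witness z}
    ... | yes (_ , _ , ¬Vy) = ¬Vy wy
    ... | no _ = wy

    witness-∋ : ∀ (V : Open S) {z} → set V z → ¬ set V y → set (witness z) z
    witness-∋ V {z} Vz ¬Vy with em {Witness z}
    ... | yes (_ , V′z , _) = V′z
    ... | no ¬w = ⊥-elim (¬w (V , Vz , ¬Vy))

    contains : ∀ (V : Open S) → ¬ set V y → set V ⊆ set (⋃O Carrier witness)
    contains V ¬Vy {z} Vz = z , witness-∋ V Vz ¬Vy

  complLocallyIndiscrete⇒¬∪-open : (M : Open S) → ComplLocallyIndiscrete S (set M) →
    ∀ (U : Open S) → IsOpen (λ x → ¬ set U x ⊎ set M x)
  complLocallyIndiscrete⇒¬∪-open M li U =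
    open-resp (from , to) (isOpen (_∨O_ S cover M))
    where
    cover : Open S
    cover = ⋃O (Σ Carrier λ y → ¬ set M y × ¬ set U y)
               (λ (y , ¬My , _) → proj₁ (li y ¬My))

    to : ∀ {x} → ¬ set U x ⊎ set M x → set cover x ⊎ set M x
    to {x} (inj₁ ¬Ux) with lem (set M x)
    ... | inj₁ Mx = inj₂ Mx
    ... | inj₂ ¬Mx = inj₁ ((x , ¬Mx , ¬Ux) , proj₁ (proj₂ (li x ¬Mx)))
    to (inj₂ Mx) = inj₂ Mx

    from : ∀ {x} → set cover x ⊎ set M x → ¬ set U x ⊎ set M x
    from {x} (inj₁ ((y , ¬My , ¬Uy) , Wx)) with lem (set M x) | li y ¬My
    ... | inj₁ Mx | _ = inj₂ Mx
    ... | inj₂ ¬Mx | W , Wy , indiscrete with indiscrete U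
    ...   | inj₁ U-misses = inj₁ (U-misses x ¬Mx Wx)
    ...   | inj₂ U-covers = ⊥-elim (¬Uy (U-covers y ¬My Wy))
    from (inj₂ Mx) = inj₂ Mx

  ¬∪-open⇒complLocallyIndiscrete : (M : Subset Carrier) →
    (∀ (U : Open S) → IsOpen (λ x → ¬ set U x ⊎ M x)) → ComplLocallyIndiscrete S M
  ¬∪-open⇒complLocallyIndiscrete M ¬∪M-open y ¬My with largestOpenAvoiding y
  ... | O , ¬Oy , maximal = W , inj₁ ¬Oy , indiscrete
    where
    W : Open S
    W = mkOpen (λ x → ¬ set O x ⊎ M x) (¬∪M-open O)

    misses : ∀ (V : Open S) → ¬ set V y → ∀ z → ¬ M z → set W z → ¬ set V z
    misses V ¬Vy z ¬Mz (inj₁ ¬Oz) Vz = ¬Oz (maximal V ¬Vy Vz)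
    misses V ¬Vy z ¬Mz (inj₂ Mz) Vz = ¬Mz Mz

    -- if y ∈ V then y ∉ ¬V ∪ M, so W − M misses ¬V as well
    indiscrete : ∀ (V : Open S) → (∀ z → ¬ M z → set W z → ¬ set V z)
                     ⊎ (∀ z → ¬ M z → set W z → set V z)
    indiscrete V with lem (set V y)
    ... | inj₂ ¬Vy = inj₁ (misses V ¬Vy)
    ... | inj₁ Vy = inj₂ covers
      where
      ¬V∪M : Open S
      ¬V∪M = mkOpen (λ x → ¬ set V x ⊎ M x) (¬∪M-open V)

      covers : ∀ z → ¬ M z → set W z → set V z
      covers z ¬Mz Wz with lem (set V z)
      ... | inj₁ Vz = Vz
      ... | inj₂ ¬Vz =
        ⊥-elim (misses ¬V∪M [ (λ ¬Vy → ¬Vy Vy) , ¬My ] z ¬Mz Wz (inj₁ ¬Vz))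

  module RelativeImplication (M : Subset Carrier)
    (¬∪M-open : ∀ (U : Open S) → IsOpen (λ x → ¬ set U x ⊎ M x)) where

    _⇒_ : Open S → Open S → Open S
    U ⇒ V = mkOpen (λ x → ¬ set U x ⊎ set V x ⊎ M x)
                   (open-resp (⊎-exchange , ⊎-exchange)
                              (isOpen (_∨O_ S V (mkOpen _ (¬∪M-open U)))))

    isImplication : IsImplication S _⇒_
    isImplication = record
      { antitone₁ = λ a≤a′ → map₁ (λ ¬a′ a → ¬a′ (a≤a′ a))
      ; monotone₂ = λ b≤b′ → map₂ (map₁ b≤b′)
      ; refl⇒     = λ a → (λ _ → tt) ,
                            λ {x} _ → [ inj₂ ∘ inj₁ , inj₁ ] (lem (set a x))
      ; trans⇒    = λ a b c → trans
      }
      where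
      trans : ∀ {A B C D : Set} → (¬ A ⊎ B ⊎ D) × (¬ B ⊎ C ⊎ D) → ¬ A ⊎ C ⊎ D
      trans (inj₁ ¬a , _) = inj₁ ¬a
      trans (inj₂ (inj₂ d) , _) = inj₂ (inj₂ d)
      trans (inj₂ (inj₁ b) , inj₁ ¬b) = ⊥-elim (¬b b)
      trans (inj₂ (inj₁ _) , inj₂ c) = inj₂ c

    isOpenImp : IsOpenImp S _⇒_
    isOpenImp a b c a∧b≤c {x} ax with lem (set b x)
    ... | inj₁ bx = inj₂ (inj₁ (a∧b≤c (ax , bx)))
    ... | inj₂ ¬bx = inj₁ ¬bx

    isClosedImp : IsClosedImp S _⇒_
    isClosedImp a b c a≤b∨c = (λ _ → tt) , λ {x} _ → cases x
      where
      cases : ∀ x → set (a ⇒ b) x ⊎ set c x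
      cases x with lem (set a x)
      ... | inj₂ ¬ax = inj₁ (inj₁ ¬ax)
      ... | inj₁ ax = map₁ (inj₂ ∘ inj₁) (a≤b∨c ax)

    isWeaklyBoolean : IsWeaklyBoolean S _⇒_
    isWeaklyBoolean = isImplication , isOpenImp , isClosedImp

  module WeaklyBooleanImplication (_⇒_ : Open S → Open S → Open S)
    (isImplication : IsImplication S _⇒_) (isOpenImp : IsOpenImp S _⇒_)
    (isClosedImp : IsClosedImp S _⇒_) where
    open IsImplication isImplication

    ¬X : Open S
    ¬X = ⊤O S ⇒ ⊥O S

    ⇒⊥-or-self : ∀ (U : Open S) x → set (U ⇒ ⊥O S) x ⊎ set U x
    ⇒⊥-or-self U x = proj₂ (isClosedImp U (⊥O S) U inj₂) tt

    ⊆-⇒ : ∀ U V → set V ⊆ set (U ⇒ V)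
    ⊆-⇒ U V = isOpenImp V U V proj₁

    ⇒-representation : ∀ U V → set (U ⇒ V) ≐ (λ x → ¬ set U x ⊎ set V x ⊎ set ¬X x)
    ⇒-representation U V = to , from
      where
      to : ∀ {x} → set (U ⇒ V) x → ¬ set U x ⊎ set V x ⊎ set ¬X x
      to {x} U⇒Vx with lem (set U x) | ⇒⊥-or-self V x
      ... | inj₂ ¬Ux | _ = inj₁ ¬Ux
      ... | inj₁ _ | inj₂ Vx = inj₂ (inj₁ Vx)
      ... | inj₁ Ux | inj₁ V⇒⊥x =
        inj₂ (inj₂ (trans⇒ (⊤O S) V (⊥O S)
                      (trans⇒ (⊤O S) U V (⊆-⇒ (⊤O S) U Ux , U⇒Vx) , V⇒⊥x)))

      from : ∀ {x} → ¬ set U x ⊎ set V x ⊎ set ¬X x → set (U ⇒ V) x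
      from {x} (inj₁ ¬Ux) with ⇒⊥-or-self U x
      ... | inj₁ U⇒⊥x = monotone₂ (λ ()) U⇒⊥x
      ... | inj₂ Ux = ⊥-elim (¬Ux Ux)
      from (inj₂ (inj₁ Vx)) = ⊆-⇒ U V Vx
      from (inj₂ (inj₂ ¬Xx)) = monotone₂ (λ ()) (antitone₁ (λ _ → tt) ¬Xx)

    ¬∪¬X-open : ∀ (U : Open S) → IsOpen (λ x → ¬ set U x ⊎ set ¬X x)
    ¬∪¬X-open U with ⇒-representation U (⊥O S)
    ... | to , from =
      open-resp (map₂ [ (λ ()) , id ] ∘ to , from ∘ map₂ inj₂) (isOpen (U ⇒ ⊥O S))

corollary3p16 : ExcludedMiddle (lsuc 0ℓ) → (S : Space) →
    ((M : Open S) → ComplLocallyIndiscrete S (set M) →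
      Σ (Open S → Open S → Open S) λ _⇒_ →
        (∀ U V → set (U ⇒ V) ≐ (λ x → ¬ set U x ⊎ set V x ⊎ set M x))
        × IsWeaklyBoolean S _⇒_)
    × ((_⇒_ : Open S → Open S → Open S) → IsWeaklyBoolean S _⇒_ →
        (∀ U V → set (U ⇒ V)
                   ≐ (λ x → ¬ set U x ⊎ set V x ⊎ set (⊤O S ⇒ ⊥O S) x))
        × ComplLocallyIndiscrete S (set (⊤O S ⇒ ⊥O S)))
corollary3p16 em S =
  (λ M li →
    let open RelativeImplication em S (set M) (complLocallyIndiscrete⇒¬∪-open em S M li)
    in _⇒_ , (λ U V → id , id) , isWeaklyBoolean)
  ,
  (λ _⇒_ (isImplication , isOpenImp , isClosedImp) →
    let open WeaklyBooleanImplication em S _⇒_ isImplication isOpenImp isClosedImp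
    in ⇒-representation , ¬∪-open⇒complLocallyIndiscrete em S (set ¬X) ¬∪¬X-open)
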